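{- Let $(\gamma,\delta)$ be a pair of partitions. For each part $\delta_j$ of $\delta$, let $d_j$ be the number of indices $i\ge2$ with $\gamma_i>\delta_j$ minus the number of unbalanced parts among $\delta_1,\ldots,\delta_{j-1}$. Then $d_j\ge 0$ for every $j$.
   Context: A partition is a finite nonincreasing sequence of positive integers; set $\gamma_i=0$ for $i>l(\gamma)$. For a pair of partitions $(\gamma,\delta)$, the parts of $\delta$ are classified as balanced or unbalanced recursively in order $j=1,2,\ldots$: the part $\delta_j$ is balanced if $\gamma_{j+1}\le\delta_j$ and the number of indices $i\ge 2$ with $\gamma_i>\delta_j$ equals the number of unbalanced parts among $\delta_1,\ldots,\delta_{j-1}$; otherwise $\delta_j$ is unbalanced. -}

module Defs where

open import Data.Nat using (ℕ; zero; suc; _+_; _≤_; _<_; _≤?_; _<?_; _≟_)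
open import Data.Bool using (Bool; true; false; _∧_; not)
open import Data.List using (List; []; _∷_; length; filter; take; drop; head)
open import Data.List.Relation.Unary.All using (All)
open import Data.List.Relation.Unary.Linked using (Linked)
open import Data.Maybe using (Maybe; just; nothing)
open import Data.Fin using (Fin; toℕ)
open import Relation.Nullary.Decidable using (⌊_⌋)

IsPartition : List ℕ → Set
IsPartition λs = All (λ x → 1 ≤ x) λs × Linked (λ a b → b ≤ a) λs
  where open import Data.Product using (_×_)

-- Entry γ_i with 1-based index i, and γ_i = 0 for i > ℓ(γ) (and for i = 0).
entry : List ℕ → ℕ → ℕ
entry _ zero = 0
entry [] (suc _) = 0
entry (x ∷ _) (suc zero) = x
entry (_ ∷ xs) (suc (suc i)) = entry xs (suc i)

-- Number of indices i ≥ 2 with γ_i > x (only finitely many nonzero γ_i matter,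
-- and x ≥ 0, so zero padding entries never count).
countAbove : List ℕ → ℕ → ℕ
countAbove γ x = length (filter (λ y → x <? y) (drop 1 γ))

-- Balanced test for the part y = δ_j (1-based index j), given u = number of
-- unbalanced parts among δ_1 … δ_{j-1}.
isBalanced : List ℕ → ℕ → ℕ → ℕ → Bool
isBalanced γ j u y = ⌊ entry γ (suc j) ≤? y ⌋ ∧ ⌊ countAbove γ y ≟ u ⌋

-- Number of unbalanced parts among the first k parts of δ.
-- unbalancedAux γ j u ds : processes the remaining parts ds, the first of which
-- is δ_j, with u unbalanced parts seen so far; returns the final count.
unbalancedAux : List ℕ → ℕ → ℕ → List ℕ → ℕ
unbalancedAux γ j u [] = u
unbalancedAux γ j u (y ∷ ds) with isBalanced γ j u y
... | true  = unbalancedAux γ (suc j) u ds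
... | false = unbalancedAux γ (suc j) (suc u) ds

unbalancedBefore : List ℕ → List ℕ → ℕ → ℕ
unbalancedBefore γ δ k = unbalancedAux γ 1 0 (take k δ)

module Submission where

-- The proof is an induction along δ with the invariant
--     u_j < j   and   u_j ≤ c(δ_j).
-- Passing from δ_j to δ_{j+1} ≤ δ_j, the counting function c is antitone, so a
-- balanced part keeps the invariant.  An unbalanced part increments u, and then
--   * either c(δ_j) ≠ u_j, so u_j < c(δ_j) ≤ c(δ_{j+1});
--   * or δ_j < γ_{j+1}, so γ_2, …, γ_{j+1} all exceed δ_{j+1} and c(δ_{j+1}) ≥ j > u_j.

open import Defs
open import Data.Nat using (ℕ; suc)
open import Data.Integer using (ℤ; +_; _-_; _≤_)
open import Data.List using (List; length; lookup)
open import Data.Fin using (Fin; toℕ)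

open import Data.Nat as ℕ using (zero; z≤n; s≤s; _<?_; _≤?_; _≟_)
open import Data.Nat.Properties
  using (≤-refl; ≤-trans; <-≤-trans; ≤-<-trans; m≤n⇒m≤1+n; ≤∧≢⇒<; ≰⇒>)
open import Data.Integer using (+≤+)
open import Data.Integer.Properties using (i≤j⇒0≤j-i)
open import Data.List using ([]; _∷_; filter; take)
open import Data.List.Properties using (filter-accept; filter-reject)
open import Data.List.Relation.Unary.Linked as Linked using (Linked; _∷_)
open import Data.Bool using (Bool; true; false)
open import Data.Product using (_×_; _,_; proj₂)
open import Data.Sum using (_⊎_; inj₁; inj₂)
open import Relation.Nullary using (yes; no; ¬_)
open import Relation.Binary.PropositionalEquality using (_≡_; _≢_; refl; sym)
open import Data.Empty using (⊥-elim)

Nonincreasing : List ℕ → Set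
Nonincreasing = Linked (λ a b → b ℕ.≤ a)

countGreater : ℕ → List ℕ → ℕ
countGreater y t = length (filter (y <?_) t)

countGreater-accept : ∀ {y x} xs → y ℕ.< x → countGreater y (x ∷ xs) ≡ suc (countGreater y xs)
countGreater-accept {y} xs y<x rewrite filter-accept (y <?_) {xs = xs} y<x = refl

countGreater-reject : ∀ {y x} xs → ¬ y ℕ.< x → countGreater y (x ∷ xs) ≡ countGreater y xs
countGreater-reject {y} xs y≮x rewrite filter-reject (y <?_) {xs = xs} y≮x = refl

countGreater-antitone : ∀ {y y′} t → y′ ℕ.≤ y → countGreater y t ℕ.≤ countGreater y′ t
countGreater-antitone [] _ = z≤n
countGreater-antitone {y} {y′} (x ∷ xs) y′≤y with y <? x | y′ <? x
... | yes y<x | yes y′<x rewrite countGreater-accept xs y<x | countGreater-accept xs y′<x =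
  s≤s (countGreater-antitone xs y′≤y)
... | yes y<x | no y′≮x = ⊥-elim (y′≮x (≤-<-trans y′≤y y<x))
... | no y≮x | yes y′<x rewrite countGreater-reject xs y≮x | countGreater-accept xs y′<x =
  m≤n⇒m≤1+n (countGreater-antitone xs y′≤y)
... | no y≮x | no y′≮x rewrite countGreater-reject xs y≮x | countGreater-reject xs y′≮x =
  countGreater-antitone xs y′≤y

countAbove-antitone : ∀ γ {y y′} → y′ ℕ.≤ y → countAbove γ y ℕ.≤ countAbove γ y′
countAbove-antitone [] _ = z≤n
countAbove-antitone (_ ∷ γ) = countGreater-antitone γ

entry≤head : ∀ x xs i → Nonincreasing (x ∷ xs) → entry (x ∷ xs) i ℕ.≤ x
entry≤head x xs zero _ = z≤n
entry≤head x xs (suc zero) _ = ≤-refl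
entry≤head x [] (suc (suc i)) _ = z≤n
entry≤head x (x′ ∷ xs) (suc (suc i)) (x′≤x ∷ s) = ≤-trans (entry≤head x′ xs (suc i) s) x′≤x

countGreater-entry : ∀ y t i → Nonincreasing t → y ℕ.< entry t i → i ℕ.≤ countGreater y t
countGreater-entry y t zero _ _ = z≤n
countGreater-entry y (x ∷ xs) (suc i) s y<tᵢ
  rewrite countGreater-accept xs (<-≤-trans y<tᵢ (entry≤head x xs (suc i) s)) = s≤s (rest i y<tᵢ)
  where
  rest : ∀ i → y ℕ.< entry (x ∷ xs) (suc i) → i ℕ.≤ countGreater y xs
  rest zero _ = z≤n
  rest (suc i) y<xsᵢ = countGreater-entry y xs (suc i) (Linked.tail s) y<xsᵢ

countAbove-entry : ∀ γ y i → Nonincreasing γ → y ℕ.< entry γ (suc i) → i ℕ.≤ countAbove γ y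
countAbove-entry γ y zero _ _ = z≤n
countAbove-entry (x ∷ xs) y (suc i) s y<γᵢ₊₁ = countGreater-entry y xs (suc i) (Linked.tail s) y<γᵢ₊₁

unbalanced-reason : ∀ γ j u y → isBalanced γ j u y ≡ false →
  y ℕ.< entry γ (suc j) ⊎ countAbove γ y ≢ u
unbalanced-reason γ j u y unbal with entry γ (suc j) ≤? y | countAbove γ y ≟ u
... | no γⱼ₊₁≰y | _ = inj₁ (≰⇒> γⱼ₊₁≰y)
... | yes _ | no c≢u = inj₂ c≢u
... | yes _ | yes _ with unbal
... | ()

bump : Bool → ℕ → ℕ
bump true u = u
bump false u = suc u

nextCount : List ℕ → ℕ → ℕ → ℕ → ℕ
nextCount γ j u y = bump (isBalanced γ j u y) u

unbalancedAux-∷ : ∀ γ j u y ds →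
  unbalancedAux γ j u (y ∷ ds) ≡ unbalancedAux γ (suc j) (nextCount γ j u y) ds
unbalancedAux-∷ γ j u y ds with isBalanced γ j u y
... | true = refl
... | false = refl

nextCount-invariant : ∀ γ j u y y′ → Nonincreasing γ → u ℕ.< j →
  u ℕ.≤ countAbove γ y → y′ ℕ.≤ y →
  nextCount γ j u y ℕ.< suc j × nextCount γ j u y ℕ.≤ countAbove γ y′
nextCount-invariant γ j u y y′ sγ u<j u≤c y′≤y with isBalanced γ j u y in balance
... | true = m≤n⇒m≤1+n u<j , ≤-trans u≤c (countAbove-antitone γ y′≤y)
... | false = s≤s u<j , bound (unbalanced-reason γ j u y balance)
  where
  bound : y ℕ.< entry γ (suc j) ⊎ countAbove γ y ≢ u → suc u ℕ.≤ countAbove γ y′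
  bound (inj₁ y<γⱼ₊₁) = ≤-trans u<j (countAbove-entry γ y′ j sγ (≤-<-trans y′≤y y<γⱼ₊₁))
  bound (inj₂ c≢u) = ≤-trans (≤∧≢⇒< u≤c (λ u≡c → c≢u (sym u≡c))) (countAbove-antitone γ y′≤y)

unbalanced≤countAbove : ∀ γ → Nonincreasing γ → ∀ y ds j u →
  Nonincreasing (y ∷ ds) → u ℕ.< j → u ℕ.≤ countAbove γ y →
  (k : Fin (length (y ∷ ds))) →
  unbalancedAux γ j u (take (toℕ k) (y ∷ ds)) ℕ.≤ countAbove γ (lookup (y ∷ ds) k)
unbalanced≤countAbove γ sγ y ds j u sδ u<j u≤c Fin.zero = u≤c
unbalanced≤countAbove γ sγ y (y′ ∷ ds) j u (y′≤y ∷ sδ) u<j u≤c (Fin.suc k)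
  rewrite unbalancedAux-∷ γ j u y (take (toℕ k) (y′ ∷ ds)) =
  let u′<j′ , u′≤c′ = nextCount-invariant γ j u y y′ sγ u<j u≤c y′≤y
  in unbalanced≤countAbove γ sγ y′ ds (suc j) (nextCount γ j u y) sδ u′<j′ u′≤c′ k

proposition2p3 : (γ δ : List ℕ) → IsPartition γ → IsPartition δ →
    (j : Fin (length δ)) →
    + 0 ≤ + countAbove γ (lookup δ j) - + unbalancedBefore γ δ (toℕ j)
proposition2p3 γ (y ∷ ds) pγ pδ j =
  i≤j⇒0≤j-i (+≤+ (unbalanced≤countAbove γ (proj₂ pγ) y ds 1 0 (proj₂ pδ) (s≤s z≤n) z≤n j))
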